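{- For all $n\ge 1$, \[ g^{ -1}(n)=\sum_{d\mid n}\mu\!\left(\frac{n}{d}\right)\lambda(d)\,C_{\Omega}(d), \] where $g^{ -1}$ is the Dirichlet inverse of $g(n)=\omega(n)+1$.
   Context: $\mu$ is the Möbius function, $\lambda(n)=(-1)^{\Omega(n)}$ the Liouville function, $\omega(n)$ the number of distinct prime divisors of $n$ ($\omega(1)=0$), $\Omega(n)$ the number of prime divisors counted with multiplicity. $C_{\Omega}(1)=1$ and, for $n\ge 2$ with prime factorization $n=\prod p^{\alpha}$, $C_{\Omega}(n)=\Omega(n)!\prod_{p^{\alpha}\| n}\frac{1}{\alpha!}$. The Dirichlet inverse $g^{ -1}$ satisfies $\sum_{d\mid n}g(d)g^{ -1}(n/d)=1$ if $n=1$ and $0$ otherwise. -}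

module Defs where

open import Data.Nat as ℕ using (ℕ; zero; suc; NonZero)
open import Data.Nat.Properties using (m*n≢0)
open import Data.Nat.Divisibility using (_∣_; _∣?_)
open import Data.Nat.Primality using (Prime; prime?)
open import Data.Nat.Base using (_!)
open import Data.Nat.Properties using (_!≢0)
open import Data.Integer as ℤ using (ℤ; +_; -_)
open import Data.List using (List; []; _∷_; filter; map; upTo; length)
open import Data.Bool using (if_then_else_)
open import Relation.Binary.PropositionalEquality using (_≡_)
open import Relation.Nullary.Decidable using (does)

-- Arithmetic functions are maps ℕ → ℤ; only their values at n ≥ 1 matter.

range1 : ℕ → List ℕ
range1 n = map suc (upTo n)

primesUpTo : ℕ → List ℕ
primesUpTo n = filter prime? (range1 n)

primeDivisors : ℕ → List ℕ
primeDivisors n = filter (λ p → p ∣? n) (primesUpTo n)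

-- p-adic valuation of n ≥ 1: number of k ∈ [1..n] with p^k ∣ n
val : ℕ → ℕ → ℕ
val p n = length (filter (λ k → (p ℕ.^ k) ∣? n) (range1 n))

ω : ℕ → ℕ
ω n = length (primeDivisors n)

sumℕ : List ℕ → ℕ
sumℕ []       = 0
sumℕ (x ∷ xs) = x ℕ.+ sumℕ xs

Ω : ℕ → ℕ
Ω n = sumℕ (map (λ p → val p n) (primeDivisors n))

neg1^ : ℕ → ℤ
neg1^ zero    = + 1
neg1^ (suc k) = - neg1^ k

liouville : ℕ → ℤ
liouville n = neg1^ (Ω n)

squarefree? : ℕ → Data.Bool.Bool
squarefree? n = go (primeDivisors n)
  where
  go : List ℕ → Data.Bool.Bool
  go []       = Data.Bool.true
  go (p ∷ ps) = if does ((p ℕ.* p) ∣? n) then Data.Bool.false else go ps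

μ : ℕ → ℤ
μ n = if squarefree? n then neg1^ (ω n) else + 0

prodFact : List ℕ → ℕ
prodFact []       = 1
prodFact (a ∷ as) = (a !) ℕ.* prodFact as

prodFact≢0 : ∀ as → NonZero (prodFact as)
prodFact≢0 []       = _
prodFact≢0 (a ∷ as) = m*n≢0 (a !) (prodFact as) {{a !≢0}} {{prodFact≢0 as}}

CΩ : ℕ → ℕ
CΩ n = ℕ._/_ (Ω n !) (prodFact es) {{prodFact≢0 es}}
  where es = map (λ p → val p n) (primeDivisors n)

sumℤ : List ℤ → ℤ
sumℤ []       = + 0
sumℤ (x ∷ xs) = x ℤ.+ sumℤ xs

divisorSum : ℕ → (ℕ → ℕ → ℤ) → ℤ
divisorSum n f =
  sumℤ (map (λ k → if does (suc k ∣? n) then f (suc k) (ℕ._/_ n (suc k)) else + 0) (upTo n))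

_⋆_ : (ℕ → ℤ) → (ℕ → ℤ) → ℕ → ℤ
(f ⋆ g) n = divisorSum n (λ d e → f d ℤ.* g e)

εD : ℕ → ℤ
εD 1 = + 1
εD _ = + 0

IsDirichletInverse : (ℕ → ℤ) → (ℕ → ℤ) → Set
IsDirichletInverse g h = ∀ n → 1 ℕ.≤ n → (g ⋆ h) n ≡ εD n


gω : ℕ → ℤ
gω n = + (ω n ℕ.+ 1)

{-# OPTIONS --safe #-}
-- Let K = 𝟙 ✶ g⁻¹ and let ℙ be the indicator function of the primes. Since ω = ℙ ✶ 𝟙, we have
-- g = 𝟙 + ℙ ✶ 𝟙, so g ✶ g⁻¹ = ε becomes K + ℙ ✶ K = ε. This recursion has only one solution,
-- because (ℙ ✶ K)(n) involves K only at the proper divisors n/p. The function λ·CΩ solves it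
-- as well: λ(n/p) = −λ(n), and CΩ(n) = Σ_{p ∣ n prime} CΩ(n/p) is Pascal's rule for multinomial
-- coefficients. Hence K = λ·CΩ, and Möbius inversion g⁻¹ = μ ✶ K gives the formula.
module Submission where

open import Defs
open import Data.Nat using (ℕ; _≤_)
open import Data.Integer using (ℤ; +_; _*_)
open import Relation.Binary.PropositionalEquality using (_≡_)

import Data.Nat as ℕ
open import Data.Nat using (zero; suc; _<_; z≤n; s≤s; _≟_; _≤?_; _^_; _!)
open import Data.Nat.Base using (>-nonZero; nonTrivial⇒n>1)
import Data.Nat.Properties as ℕ
open import Data.Nat.Divisibility
  using (_∣_; _∣?_; divides; ∣⇒≤; ∣-trans; n∣m*n; m∣m*n; *-cancelˡ-∣; *-monoʳ-∣; >⇒∤; 1∣_)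
open import Data.Nat.DivMod using (m*n/n≡m; m/n*n≡m; /-congˡ)
open import Data.Nat.Induction using (<-rec)
open import Data.Nat.ListAction using (product)
open import Data.Nat.Primality
  using (Prime; prime?; euclidsLemma; prime⇒irreducible; prime⇒nonZero; prime⇒nonTrivial)
open import Data.Nat.Primality.Factorisation using (factorise)
open import Data.Integer using (_+_; -_; ∣_∣)
import Data.Integer.Properties as ℤ
open import Data.Bool using (Bool; true; false; _∧_; not; if_then_else_)
open import Data.Bool.Properties using (∧-isCommutativeMonoid; ∧-identityʳ; ∧-zeroʳ; if-∧; if-float)
open import Data.List using (List; []; _∷_; map; filter; foldr; upTo; length; _++_; [_])
open import Data.List.Properties using (upTo-∷ʳ; map-++; map-∘)
open import Data.List.Relation.Unary.All using (_∷_)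
open import Data.Product using (_×_; _,_; proj₁; proj₂; ∃)
open import Data.Sum using (inj₁; inj₂)
open import Function using (_∘_)
open import Function.Bundles using (mk⇔)
open import Algebra.Core using (Op₂)
open import Algebra.Bundles using (AbelianGroup)
open import Algebra.Structures using (IsCommutativeMonoid)
open import Algebra.Properties.Group (AbelianGroup.group ℤ.+-0-abelianGroup) using (∙-cancelʳ)
open import Algebra.Properties.CommutativeSemigroup ℤ.*-commutativeSemigroup using (x∙yz≈y∙xz)
open import Relation.Nullary using (Dec; yes; no; ¬_; ¬?; contradiction)
open import Relation.Nullary.Decidable using (does; dec-true; dec-false; does-⇔; _×-dec_)
open import Relation.Unary using (Pred; Decidable)
open import Relation.Binary.PropositionalEquality
  using (_≢_; refl; sym; trans; cong; cong₂; subst; module ≡-Reasoning)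

1≤m*n : ∀ {m n} → 1 ≤ m → 1 ≤ n → 1 ≤ m ℕ.* n
1≤m*n {suc m} {suc n} _ _ = s≤s z≤n

1≤m*n⇒1≤m : ∀ m n → 1 ≤ m ℕ.* n → 1 ≤ m
1≤m*n⇒1≤m (suc m) n _ = s≤s z≤n

1≤m*n⇒1≤n : ∀ m n → 1 ≤ m ℕ.* n → 1 ≤ n
1≤m*n⇒1≤n m (suc n) _ = s≤s z≤n
1≤m*n⇒1≤n m zero    h = contradiction (subst (1 ≤_) (ℕ.*-zeroʳ m) h) λ ()

factor≤ˡ : ∀ {d e m} → 1 ≤ e → d ℕ.* e ≡ m → d ≤ m
factor≤ˡ {d} {e} e≥1 refl = ℕ.m≤m*n d e
  where instance _ = >-nonZero e≥1

factor≤ʳ : ∀ {d e m} → 1 ≤ d → d ℕ.* e ≡ m → e ≤ m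
factor≤ʳ {d} {e} d≥1 refl = ℕ.m≤n*m e d
  where instance _ = >-nonZero d≥1

prime>1 : ∀ {p} → Prime p → 1 < p
prime>1 {p} pp = nonTrivial⇒n>1 p {{prime⇒nonTrivial pp}}

prime≥1 : ∀ {p} → Prime p → 1 ≤ p
prime≥1 pp = ℕ.<⇒≤ (prime>1 pp)

prime∣prime⇒≡ : ∀ {q p} → Prime q → Prime p → q ∣ p → q ≡ p
prime∣prime⇒≡ qp pp q∣p with prime⇒irreducible pp q∣p
... | inj₁ refl = contradiction qp λ ()
... | inj₂ q≡p  = q≡p

^-∣-*-other : ∀ {q p} → Prime q → Prime p → q ≢ p → ∀ k {e} → q ^ k ∣ p ℕ.* e → q ^ k ∣ e
^-∣-*-other qp pp q≢p zero    _ = 1∣ _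
^-∣-*-other {q} {p} qp pp q≢p (suc k) {e} qqᵏ∣pe
  with euclidsLemma p e qp (∣-trans (m∣m*n (q ^ k)) qqᵏ∣pe)
... | inj₁ q∣p               = contradiction (prime∣prime⇒≡ qp pp q∣p) q≢p
... | inj₂ (divides e′ refl) =
  subst (q ^ suc k ∣_) (ℕ.*-comm q e′) (*-monoʳ-∣ q (^-∣-*-other qp pp q≢p k (*-cancelˡ-∣ q qᵏ∣pe′)))
  where
  instance _ = prime⇒nonZero qp
  qᵏ∣pe′ : q ℕ.* q ^ k ∣ q ℕ.* (p ℕ.* e′)
  qᵏ∣pe′ = subst (q ^ suc k ∣_) (trans (sym (ℕ.*-assoc p e′ q)) (ℕ.*-comm _ q)) qqᵏ∣pe

n<m^n : ∀ {m} n → 1 < m → n < m ^ n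
n<m^n zero    _   = s≤s z≤n
n<m^n {m} (suc n) 1<m = ℕ.≤-<-trans (n<m^n n 1<m) (ℕ.^-monoʳ-< m 1<m (ℕ.n<1+n n))

n<p*n : ∀ {p n} → Prime p → 1 ≤ n → n < p ℕ.* n
n<p*n {p} {n} pp n≥1 = subst (n <_) (ℕ.*-comm n p) (ℕ.m<m*n n p {{>-nonZero n≥1}} (prime>1 pp))

>⇒^∤ : ∀ {q e} k → 1 < q → 1 ≤ e → e < k → ¬ q ^ k ∣ e
>⇒^∤ k 1<q e≥1 e<k = >⇒∤ {{>-nonZero e≥1}} (ℕ.<-trans e<k (n<m^n k 1<q))

PrimeDivisor : ℕ → ℕ → Set
PrimeDivisor n q = Prime q × q ∣ n

primeDivisor? : ∀ n q → Dec (PrimeDivisor n q)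
primeDivisor? n q = prime? q ×-dec q ∣? n

primeDivisor-*⁻ : ∀ {p e q} → Prime p → q ≢ p → PrimeDivisor (p ℕ.* e) q → PrimeDivisor e q
primeDivisor-*⁻ {p} {e} pp q≢p (qp , q∣pe) with euclidsLemma p e qp q∣pe
... | inj₁ q∣p = contradiction (prime∣prime⇒≡ qp pp q∣p) q≢p
... | inj₂ q∣e = qp , q∣e

primeDivisor-*⁺ : ∀ p {e q} → PrimeDivisor e q → PrimeDivisor (p ℕ.* e) q
primeDivisor-*⁺ p (qp , q∣e) = qp , ∣-trans q∣e (n∣m*n p)

>⇒¬primeDivisor : ∀ {n q} → 1 ≤ n → n < q → ¬ PrimeDivisor n q
>⇒¬primeDivisor n≥1 n<q (_ , q∣n) = >⇒∤ {{>-nonZero n≥1}} n<q q∣n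

prime-divisor : ∀ n → 2 ≤ n → ∃ (PrimeDivisor n)
prime-divisor (suc zero) (s≤s ())
prime-divisor n@(suc (suc _)) _ with factorise n
... | record { factors = p ∷ ps ; isFactorisation = n≡p*Πps ; factorsPrime = pp ∷ _ } =
  p , pp , divides (product ps) (trans n≡p*Πps (ℕ.*-comm p _))

prime∤⇒*-∣ : ∀ {p j n} → Prime p → ¬ p ∣ j → j ∣ n → p ∣ n → p ℕ.* j ∣ n
prime∤⇒*-∣ {p} {j} pp p∤j (divides a n≡aj) p∣n with euclidsLemma a j pp (subst (p ∣_) n≡aj p∣n)
... | inj₂ p∣j              = contradiction p∣j p∤j
... | inj₁ (divides b a≡bp) = divides b (trans n≡aj (trans (cong (ℕ._* j) a≡bp) (ℕ.*-assoc b p j)))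

-- Sums over 1 ≤ k ≤ n in a commutative monoid

module RangeSum {A : Set} {_∙_ : Op₂ A} {ε : A} (isCM : IsCommutativeMonoid _≡_ _∙_ ε) where
  open IsCommutativeMonoid isCM using (assoc; comm; identityˡ; identityʳ)
  open ≡-Reasoning

  ∑ : ℕ → (ℕ → A) → A
  ∑ zero    f = ε
  ∑ (suc n) f = ∑ n f ∙ f (suc n)

  when : {P : Set} → Dec P → A → A
  when P? x = if does P? then x else ε

  private
    variable
      P Q : Set
      n : ℕ
      f : ℕ → A

    lower : {R : ℕ → Set} → (∀ k → 1 ≤ k → k ≤ suc n → R k) → ∀ k → 1 ≤ k → k ≤ n → R k
    lower h k k≥1 k≤n = h k k≥1 (ℕ.m≤n⇒m≤1+n k≤n)

    top : {R : ℕ → Set} → (∀ k → 1 ≤ k → k ≤ suc n → R k) → R (suc n)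
    top h = h _ (s≤s z≤n) ℕ.≤-refl

  when-yes : ∀ (P? : Dec P) {x} → P → when P? x ≡ x
  when-yes (yes _) _ = refl
  when-yes (no ¬p) p = contradiction p ¬p

  when-no : ∀ (P? : Dec P) {x} → ¬ P → when P? x ≡ ε
  when-no (yes p) ¬p = contradiction p ¬p
  when-no (no _)  _  = refl

  when-ε : ∀ (P? : Dec P) → when P? ε ≡ ε
  when-ε (yes _) = refl
  when-ε (no _)  = refl

  when-⇔ : ∀ (P? : Dec P) (Q? : Dec Q) {x} → (P → Q) → (Q → P) → when P? x ≡ when Q? x
  when-⇔ (yes p) Q? to _    = sym (when-yes Q? (to p))
  when-⇔ (no ¬p) Q? _  from = sym (when-no Q? (λ q → ¬p (from q)))

  when-cong : ∀ (P? : Dec P) {x y} → (P → x ≡ y) → when P? x ≡ when P? y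
  when-cong (yes p) eq = eq p
  when-cong (no _)  _  = refl

  when-when : ∀ (P? : Dec P) (Q? : Dec Q) {x} → (Q → P) → when P? (when Q? x) ≡ when Q? x
  when-when P? (yes q) from = when-yes P? (from q)
  when-when P? (no _)  _    = when-ε P?

  when-comm : ∀ (P? : Dec P) (Q? : Dec Q) {x} → when P? (when Q? x) ≡ when Q? (when P? x)
  when-comm (yes _) Q? = refl
  when-comm (no _)  Q? = sym (when-ε Q?)

  when-∙ : ∀ (P? : Dec P) x y → when P? (x ∙ y) ≡ when P? x ∙ when P? y
  when-∙ (yes _) x y = refl
  when-∙ (no _)  x y = sym (identityˡ ε)

  when-split : ∀ (P? : Dec P) x → x ≡ when P? x ∙ when (¬? P?) x
  when-split (yes _) x = sym (identityʳ x)
  when-split (no _)  x = sym (identityˡ x)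

  when-primeDivisor-* : ∀ {p e q} → Prime p → q ≢ p → ∀ x →
                        when (primeDivisor? (p ℕ.* e) q) x ≡ when (primeDivisor? e q) x
  when-primeDivisor-* {p} {e} {q} pp q≢p x =
    when-⇔ (primeDivisor? (p ℕ.* e) q) (primeDivisor? e q) (primeDivisor-*⁻ pp q≢p) (primeDivisor-*⁺ p)

  when-primeDivisor-> : ∀ {e q} → 1 ≤ e → e < q → ∀ x → when (primeDivisor? e q) x ≡ ε
  when-primeDivisor-> {e} {q} e≥1 e<q x = when-no (primeDivisor? e q) (>⇒¬primeDivisor e≥1 e<q)

  ∑-cong : ∀ n {f g : ℕ → A} → (∀ k → 1 ≤ k → k ≤ n → f k ≡ g k) → ∑ n f ≡ ∑ n g
  ∑-cong zero    _  = refl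
  ∑-cong (suc n) eq = cong₂ _∙_ (∑-cong n (lower eq)) (top eq)

  ∑-ε : ∀ n → (∀ k → 1 ≤ k → k ≤ n → f k ≡ ε) → ∑ n f ≡ ε
  ∑-ε zero    _  = refl
  ∑-ε (suc n) eq = trans (cong₂ _∙_ (∑-ε n (lower eq)) (top eq)) (identityˡ ε)

  ∑-distrib : ∀ n f g → ∑ n (λ k → f k ∙ g k) ≡ ∑ n f ∙ ∑ n g
  ∑-distrib zero    f g = sym (identityˡ ε)
  ∑-distrib (suc n) f g = begin
    ∑ n (λ k → f k ∙ g k) ∙ (f (suc n) ∙ g (suc n)) ≡⟨ cong (_∙ _) (∑-distrib n f g) ⟩
    (∑ n f ∙ ∑ n g) ∙ (f (suc n) ∙ g (suc n))       ≡⟨ interchange ⟩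
    (∑ n f ∙ f (suc n)) ∙ (∑ n g ∙ g (suc n))       ∎
    where
    interchange : ∀ {a b c d} → (a ∙ b) ∙ (c ∙ d) ≡ (a ∙ c) ∙ (b ∙ d)
    interchange {a} {b} {c} {d} = begin
      (a ∙ b) ∙ (c ∙ d) ≡⟨ assoc a b _ ⟩
      a ∙ (b ∙ (c ∙ d)) ≡⟨ cong (a ∙_) (sym (assoc b c d)) ⟩
      a ∙ ((b ∙ c) ∙ d) ≡⟨ cong (λ x → a ∙ (x ∙ d)) (comm b c) ⟩
      a ∙ ((c ∙ b) ∙ d) ≡⟨ cong (a ∙_) (assoc c b d) ⟩
      a ∙ (c ∙ (b ∙ d)) ≡⟨ sym (assoc a c _) ⟩
      (a ∙ c) ∙ (b ∙ d) ∎

  ∑-swap : ∀ n m (F : ℕ → ℕ → A) → ∑ n (λ i → ∑ m (F i)) ≡ ∑ m (λ j → ∑ n (λ i → F i j))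
  ∑-swap zero    m F = sym (∑-ε m (λ _ _ _ → refl))
  ∑-swap (suc n) m F = trans (cong (_∙ ∑ m (F (suc n))) (∑-swap n m F)) (sym (∑-distrib m _ _))

  when-∑ : ∀ (P? : Dec P) n f → when P? (∑ n f) ≡ ∑ n (λ k → when P? (f k))
  when-∑ (yes _) n f = refl
  when-∑ (no _)  n f = sym (∑-ε n (λ _ _ _ → refl))

  ∑-extend : ∀ {m} n → m ≤ n → (∀ k → m < k → k ≤ n → f k ≡ ε) → ∑ n f ≡ ∑ m f
  ∑-extend zero    z≤n _ = refl
  ∑-extend (suc n) m≤n vanish with ℕ.m≤n⇒m<n∨m≡n m≤n
  ... | inj₂ refl = refl
  ... | inj₁ m<n  = trans
    (cong₂ _∙_ (∑-extend n (ℕ.≤-pred m<n) λ k m<k k≤n → vanish k m<k (ℕ.m≤n⇒m≤1+n k≤n))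
               (vanish (suc n) m<n ℕ.≤-refl))
    (identityʳ _)

  ∑-update : ∀ n {f g : ℕ → A} {p c} → 1 ≤ p → p ≤ n → g p ≡ f p ∙ c →
             (∀ k → 1 ≤ k → k ≤ n → k ≢ p → g k ≡ f k) → ∑ n g ≡ ∑ n f ∙ c
  ∑-update zero    () z≤n _ _
  ∑-update (suc n) {f} {g} {p} {c} p≥1 p≤n at-p elsewhere with ℕ.m≤n⇒m<n∨m≡n p≤n
  ... | inj₂ refl = begin
    ∑ n g ∙ g (suc n)       ≡⟨ cong₂ _∙_ (∑-cong n λ k k≥1 k≤n →
                                 elsewhere k k≥1 (ℕ.m≤n⇒m≤1+n k≤n) (ℕ.<⇒≢ (s≤s k≤n))) at-p ⟩
    ∑ n f ∙ (f (suc n) ∙ c) ≡⟨ assoc _ _ c ⟨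
    (∑ n f ∙ f (suc n)) ∙ c ∎
  ... | inj₁ p<n = begin
    ∑ n g ∙ g (suc n)       ≡⟨ cong₂ _∙_ (∑-update n p≥1 (ℕ.≤-pred p<n) at-p (lower elsewhere))
                                         (top elsewhere λ eq → ℕ.<-irrefl (sym eq) p<n) ⟩
    (∑ n f ∙ c) ∙ f (suc n) ≡⟨ assoc _ c _ ⟩
    ∑ n f ∙ (c ∙ f (suc n)) ≡⟨ cong (∑ n f ∙_) (comm c _) ⟩
    ∑ n f ∙ (f (suc n) ∙ c) ≡⟨ assoc _ _ c ⟨
    (∑ n f ∙ f (suc n)) ∙ c ∎

  ∑-update-extend : ∀ {p e c} {f g : ℕ → A} → 1 ≤ p → 1 ≤ e → (∀ k → e < k → f k ≡ ε) →
                    g p ≡ f p ∙ c → (∀ k → k ≢ p → g k ≡ f k) → ∑ (p ℕ.* e) g ≡ ∑ e f ∙ c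
  ∑-update-extend {p} {e} {c} {f} {g} p≥1 e≥1 beyond at-p elsewhere = begin
    ∑ (p ℕ.* e) g     ≡⟨ ∑-update (p ℕ.* e) p≥1 (ℕ.m≤m*n p e) at-p (λ k _ _ → elsewhere k) ⟩
    ∑ (p ℕ.* e) f ∙ c ≡⟨ cong (_∙ c) (∑-extend (p ℕ.* e) (ℕ.m≤n*m e p) λ k e<k _ → beyond k e<k) ⟩
    ∑ e f ∙ c         ∎
    where instance _ = >-nonZero p≥1
                   _ = >-nonZero e≥1

  ∑-single : ∀ n {p} → 1 ≤ p → p ≤ n → (∀ k → 1 ≤ k → k ≤ n → k ≢ p → f k ≡ ε) → ∑ n f ≡ f p
  ∑-single {f = f} n p≥1 p≤n vanish = begin
    ∑ n f               ≡⟨ ∑-update n p≥1 p≤n (sym (identityˡ _)) vanish ⟩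
    ∑ n (λ _ → ε) ∙ f _ ≡⟨ cong (_∙ _) (∑-ε n λ _ _ _ → refl) ⟩
    ε ∙ f _             ≡⟨ identityˡ _ ⟩
    f _                 ∎

  ∑-absorbing : ∀ n {p z} → (∀ x → x ∙ z ≡ z) → 1 ≤ p → p ≤ n → f p ≡ z → ∑ n f ≡ z
  ∑-absorbing zero    absorb () z≤n _
  ∑-absorbing {f = f} (suc n) {z = z} absorb p≥1 p≤n fp≡z with ℕ.m≤n⇒m<n∨m≡n p≤n
  ... | inj₂ refl = trans (cong (∑ n f ∙_) fp≡z) (absorb _)
  ... | inj₁ p<n  = begin
    ∑ n f ∙ f (suc n) ≡⟨ cong (_∙ f (suc n)) (∑-absorbing n absorb p≥1 (ℕ.≤-pred p<n) fp≡z) ⟩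
    z ∙ f (suc n)     ≡⟨ comm z _ ⟩
    f (suc n) ∙ z     ≡⟨ absorb _ ⟩
    z                 ∎

  ∑-shift : ∀ n f → ∑ (suc n) f ≡ f 1 ∙ ∑ n (λ k → f (suc k))
  ∑-shift zero    f = trans (identityˡ (f 1)) (sym (identityʳ (f 1)))
  ∑-shift (suc n) f = trans (cong (_∙ f (suc (suc n))) (∑-shift n f)) (assoc (f 1) _ _)

  ∑-δ : ∀ N {x} (φ : ℕ → A) → 1 ≤ x → ∑ N (λ d → when (x ≟ d) (φ d)) ≡ when (x ≤? N) (φ x)
  ∑-δ N {x} φ x≥1 with x ≤? N
  ... | yes x≤N = begin
    ∑ N (λ d → when (x ≟ d) (φ d)) ≡⟨ ∑-single N x≥1 x≤N (λ k _ _ k≢x →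
                                        when-no (x ≟ k) λ x≡k → k≢x (sym x≡k)) ⟩
    when (x ≟ x) (φ x)             ≡⟨ when-yes (x ≟ x) refl ⟩
    φ x                            ≡⟨ when-yes (x ≤? N) x≤N ⟨
    when (x ≤? N) (φ x)            ∎
  ... | no  x≰N = begin
    ∑ N (λ d → when (x ≟ d) (φ d)) ≡⟨ ∑-ε N (λ k _ k≤N → when-no (x ≟ k) λ { refl → x≰N k≤N }) ⟩
    ε                              ≡⟨ when-no (x ≤? N) x≰N ⟨
    when (x ≤? N) (φ x)            ∎

  ∑-cofactor : ∀ N q {d j} (ψ : ℕ → A) → 1 ≤ d → d ≤ N → q ℕ.* j ≡ d →
               ∑ N (λ e → when (q ℕ.* e ≟ d) (ψ e)) ≡ ψ j
  ∑-cofactor N q {d} {j} ψ d≥1 d≤N qj≡d = trans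
    (∑-single N (1≤m*n⇒1≤n q j qj≥1) (ℕ.≤-trans (factor≤ʳ q≥1 qj≡d) d≤N) λ k _ _ k≢j →
       when-no (q ℕ.* k ≟ d) λ qk≡d → k≢j (ℕ.*-cancelˡ-≡ k j q (trans qk≡d (sym qj≡d))))
    (when-yes (q ℕ.* j ≟ d) qj≡d)
    where
    qj≥1 : 1 ≤ q ℕ.* j
    qj≥1 = subst (1 ≤_) (sym qj≡d) d≥1
    q≥1 : 1 ≤ q
    q≥1 = 1≤m*n⇒1≤m q j qj≥1
    instance _ = >-nonZero q≥1

  ∑-cofactor-∤ : ∀ N q {d} (ψ : ℕ → A) → ¬ q ∣ d → ∑ N (λ e → when (q ℕ.* e ≟ d) (ψ e)) ≡ ε
  ∑-cofactor-∤ N q {d} ψ q∤d =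
    ∑-ε N λ k _ _ → when-no (q ℕ.* k ≟ d) λ qk≡d → q∤d (divides k (trans (sym qk≡d) (ℕ.*-comm q k)))

  ∑-multiples : ∀ N {q} (φ : ℕ → A) → 1 ≤ q →
                ∑ N (λ d → when (q ∣? d) (φ d)) ≡ ∑ N (λ j → when (q ℕ.* j ≤? N) (φ (q ℕ.* j)))
  ∑-multiples N {q} φ q≥1 = begin
    ∑ N (λ d → when (q ∣? d) (φ d))                    ≡⟨ ∑-cong N cofactor-sum ⟩
    ∑ N (λ d → ∑ N (λ j → when (q ℕ.* j ≟ d) (φ d))) ≡⟨ ∑-swap N N _ ⟩
    ∑ N (λ j → ∑ N (λ d → when (q ℕ.* j ≟ d) (φ d))) ≡⟨ ∑-cong N (λ j j≥1 _ → ∑-δ N φ (1≤m*n q≥1 j≥1)) ⟩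
    ∑ N (λ j → when (q ℕ.* j ≤? N) (φ (q ℕ.* j)))     ∎
    where
    cofactor-sum : ∀ d → 1 ≤ d → d ≤ N → when (q ∣? d) (φ d) ≡ ∑ N (λ j → when (q ℕ.* j ≟ d) (φ d))
    cofactor-sum d d≥1 d≤N with q ∣? d
    ... | yes (divides j d≡jq) = sym (∑-cofactor N q (λ _ → φ d) d≥1 d≤N (trans (ℕ.*-comm q j) (sym d≡jq)))
    ... | no  q∤d              = sym (∑-cofactor-∤ N q (λ _ → φ d) q∤d)

  foldr-++-[] : ∀ xs x → foldr _∙_ ε (xs ++ [ x ]) ≡ foldr _∙_ ε xs ∙ x
  foldr-++-[] []       x = trans (identityʳ x) (sym (identityˡ x))
  foldr-++-[] (y ∷ ys) x = trans (cong (y ∙_) (foldr-++-[] ys x)) (sym (assoc y _ x))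

  foldr-range1 : ∀ n f → foldr _∙_ ε (map f (range1 n)) ≡ ∑ n f
  foldr-range1 zero    f = refl
  foldr-range1 (suc n) f = begin
    foldr _∙_ ε (map f (map suc (upTo (suc n))))
      ≡⟨ cong (λ xs → foldr _∙_ ε (map f (map suc xs))) (upTo-∷ʳ n) ⟨
    foldr _∙_ ε (map f (map suc (upTo n ++ [ n ])))
      ≡⟨ cong (λ xs → foldr _∙_ ε (map f xs)) (map-++ suc (upTo n) [ n ]) ⟩
    foldr _∙_ ε (map f (range1 n ++ [ suc n ]))
      ≡⟨ cong (foldr _∙_ ε) (map-++ f (range1 n) [ suc n ]) ⟩
    foldr _∙_ ε (map f (range1 n) ++ [ f (suc n) ])
      ≡⟨ foldr-++-[] (map f (range1 n)) (f (suc n)) ⟩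
    foldr _∙_ ε (map f (range1 n)) ∙ f (suc n)
      ≡⟨ cong (_∙ f (suc n)) (foldr-range1 n f) ⟩
    ∑ (suc n) f
      ∎

  foldr-filter : ∀ {R : Pred ℕ _} (R? : Decidable R) f xs →
                 foldr _∙_ ε (map f (filter R? xs)) ≡ foldr _∙_ ε (map (λ x → when (R? x) (f x)) xs)
  foldr-filter R? f []       = refl
  foldr-filter R? f (x ∷ xs) with R? x
  ... | yes _ = cong (f x ∙_) (foldr-filter R? f xs)
  ... | no  _ = trans (foldr-filter R? f xs) (sym (identityˡ _))

  foldr-primeDivisors : ∀ n g →
                        foldr _∙_ ε (map g (primeDivisors n)) ≡ ∑ n (λ q → when (primeDivisor? n q) (g q))
  foldr-primeDivisors n g = begin
    foldr _∙_ ε (map g (filter (_∣? n) (primesUpTo n)))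
      ≡⟨ foldr-filter (_∣? n) g (primesUpTo n) ⟩
    foldr _∙_ ε (map (λ q → when (q ∣? n) (g q)) (filter prime? (range1 n)))
      ≡⟨ foldr-filter prime? _ (range1 n) ⟩
    foldr _∙_ ε (map (λ q → when (prime? q) (when (q ∣? n) (g q))) (range1 n))
      ≡⟨ foldr-range1 n _ ⟩
    ∑ n (λ q → when (prime? q) (when (q ∣? n) (g q)))
      ≡⟨ ∑-cong n (λ q _ _ → if-∧ (does (prime? q))) ⟨
    ∑ n (λ q → when (primeDivisor? n q) (g q))
      ∎

open RangeSum ℤ.+-0-isCommutativeMonoid
module Σℕ = RangeSum ℕ.+-0-isCommutativeMonoid
module Πℕ = RangeSum ℕ.*-1-isCommutativeMonoid
module ⋀  = RangeSum ∧-isCommutativeMonoid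

sumℤ≡foldr : ∀ xs → sumℤ xs ≡ foldr _+_ (+ 0) xs
sumℤ≡foldr []       = refl
sumℤ≡foldr (x ∷ xs) = cong (_+_ x) (sumℤ≡foldr xs)

∑-*ˡ : ∀ n c f → c * ∑ n f ≡ ∑ n (λ k → c * f k)
∑-*ˡ zero    c f = ℤ.*-zeroʳ c
∑-*ˡ (suc n) c f = trans (ℤ.*-distribˡ-+ c (∑ n f) _) (cong (_+ c * f (suc n)) (∑-*ˡ n c f))

∑-neg : ∀ n f → ∑ n (λ k → - f k) ≡ - ∑ n f
∑-neg zero    f = refl
∑-neg (suc n) f = trans (cong (_+ - f (suc n)) (∑-neg n f)) (sym (ℤ.neg-distrib-+ (∑ n f) _))

-when : ∀ {P : Set} (P? : Dec P) x → - when P? x ≡ when P? (- x)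
-when (yes _) x = refl
-when (no _)  x = refl

*-when : ∀ {P : Set} (P? : Dec P) c x → c * when P? x ≡ when P? (c * x)
*-when (yes _) c x = refl
*-when (no _)  c x = ℤ.*-zeroʳ c

+∑ : ∀ n f → + Σℕ.∑ n f ≡ ∑ n (λ k → + f k)
+∑ zero    f = refl
+∑ (suc n) f = trans (ℤ.pos-+ (Σℕ.∑ n f) (f (suc n))) (cong (_+ + f (suc n)) (+∑ n f))

-- Dirichlet convolution

pairSum : ℕ → (ℕ → ℕ → ℤ) → ℤ
pairSum n F = ∑ n λ d → ∑ n λ e → when (d ℕ.* e ≟ n) (F d e)

pairSum-cong : ∀ n {F G : ℕ → ℕ → ℤ} → (∀ d e → 1 ≤ d → 1 ≤ e → d ℕ.* e ≡ n → F d e ≡ G d e) →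
               pairSum n F ≡ pairSum n G
pairSum-cong n F≡G = ∑-cong n λ d d≥1 _ → ∑-cong n λ e e≥1 _ → when-cong (d ℕ.* e ≟ n) (F≡G d e d≥1 e≥1)

pairSum-swap : ∀ n F → pairSum n F ≡ pairSum n (λ d e → F e d)
pairSum-swap n F = trans (∑-swap n n _)
  (∑-cong n λ e _ _ → ∑-cong n λ d _ _ → cong (λ x → when (x ≟ n) (F d e)) (ℕ.*-comm d e))

pairSum-*ˡ : ∀ n c F → c * pairSum n F ≡ pairSum n (λ d e → c * F d e)
pairSum-*ˡ n c F = trans (∑-*ˡ n c _)
  (∑-cong n λ d _ _ → trans (∑-*ˡ n c _) (∑-cong n λ e _ _ → *-when (d ℕ.* e ≟ n) c (F d e)))

pairSum-extend : ∀ {m} n F → m ≤ n → pairSum m F ≡ ∑ n (λ d → ∑ n (λ e → when (d ℕ.* e ≟ m) (F d e)))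
pairSum-extend {m} n F m≤n = sym (begin
  ∑ n (λ d → ∑ n (λ e → when (d ℕ.* e ≟ m) (F d e))) ≡⟨ ∑-cong n (λ d d≥1 _ → ∑-extend n m≤n λ e m<e _ →
                                                         when-no (d ℕ.* e ≟ m) (too-big d e (factor≤ʳ d≥1) m<e)) ⟩
  ∑ n (λ d → ∑ m (λ e → when (d ℕ.* e ≟ m) (F d e))) ≡⟨ ∑-extend n m≤n (λ d m<d _ → ∑-ε m λ e e≥1 _ →
                                                         when-no (d ℕ.* e ≟ m) (too-big d e (factor≤ˡ e≥1) m<d)) ⟩
  pairSum m F                                         ∎)
  where
  open ≡-Reasoning
  too-big : ∀ {x} d e → (d ℕ.* e ≡ m → x ≤ m) → m < x → d ℕ.* e ≢ m
  too-big _ _ x≤m m<x de≡m = ℕ.<⇒≱ m<x (x≤m de≡m)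

divisorTerm : ℕ → (ℕ → ℕ → ℤ) → ℕ → ℤ
divisorTerm n F zero    = + 0
divisorTerm n F (suc k) = when (suc k ∣? n) (F (suc k) (n ℕ./ suc k))

divisorSum≡∑ : ∀ n F → divisorSum n F ≡ ∑ n (divisorTerm n F)
divisorSum≡∑ n F = begin
  divisorSum n F                                         ≡⟨ sumℤ≡foldr (map (divisorTerm n F ∘ suc) (upTo n)) ⟩
  foldr _+_ (+ 0) (map (divisorTerm n F ∘ suc) (upTo n)) ≡⟨ cong (foldr _+_ (+ 0)) (map-∘ (upTo n)) ⟩
  foldr _+_ (+ 0) (map (divisorTerm n F) (range1 n))     ≡⟨ foldr-range1 n (divisorTerm n F) ⟩
  ∑ n (divisorTerm n F)                                  ∎
  where open ≡-Reasoning

divisorSum≡pairSum : ∀ n F → 1 ≤ n → divisorSum n F ≡ pairSum n F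
divisorSum≡pairSum n F n≥1 = trans (divisorSum≡∑ n F) (∑-cong n term)
  where
  term : ∀ d → 1 ≤ d → d ≤ n → divisorTerm n F d ≡ ∑ n (λ e → when (d ℕ.* e ≟ n) (F d e))
  term d@(suc _) _ _ with d ∣? n
  ... | no  d∤n                  = trans (when-no (d ∣? n) d∤n) (sym (∑-cofactor-∤ n d (F d) d∤n))
  ... | yes d∣n@(divides q n≡qd) = begin
    when (d ∣? n) (F d (n ℕ./ d)) ≡⟨ when-yes (d ∣? n) d∣n ⟩
    F d (n ℕ./ d)                 ≡⟨ cong (F d) (trans (/-congˡ n≡qd) (m*n/n≡m q d)) ⟩
    F d q                         ≡⟨ ∑-cofactor n d (F d) n≥1 ℕ.≤-refl (trans (ℕ.*-comm d q) (sym n≡qd)) ⟨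
    ∑ n (λ e → when (d ℕ.* e ≟ n) (F d e)) ∎
    where open ≡-Reasoning

pairSum-divisors : ∀ n (G : ℕ → ℤ) → 1 ≤ n → pairSum n (λ d _ → G d) ≡ ∑ n (λ d → when (d ∣? n) (G d))
pairSum-divisors n G n≥1 = trans (sym (divisorSum≡pairSum n _ n≥1))
  (trans (divisorSum≡∑ n (λ d _ → G d)) (∑-cong n λ { (suc k) _ _ → refl }))

pairSum-+ : ∀ n F G → pairSum n (λ d e → F d e + G d e) ≡ pairSum n F + pairSum n G
pairSum-+ n F G = trans
  (∑-cong n λ d _ _ → trans (∑-cong n λ e _ _ → when-∙ (d ℕ.* e ≟ n) (F d e) (G d e)) (∑-distrib n _ _))
  (∑-distrib n _ _)

infixl 7 _✶_
_✶_ : (ℕ → ℤ) → (ℕ → ℤ) → ℕ → ℤ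
(f ✶ g) n = pairSum n λ d e → f d * g e

⋆≡✶ : ∀ f g n → 1 ≤ n → (f ⋆ g) n ≡ (f ✶ g) n
⋆≡✶ f g n = divisorSum≡pairSum n _

✶-comm : ∀ f g n → (f ✶ g) n ≡ (g ✶ f) n
✶-comm f g n = trans (pairSum-swap n _) (pairSum-cong n λ d e _ _ _ → ℤ.*-comm (f e) (g d))

✶-congˡ : ∀ {f f′} g n → (∀ d → 1 ≤ d → d ≤ n → f d ≡ f′ d) → (f ✶ g) n ≡ (f′ ✶ g) n
✶-congˡ g n f≡f′ = pairSum-cong n λ d e d≥1 e≥1 de≡n → cong (_* g e) (f≡f′ d d≥1 (factor≤ˡ e≥1 de≡n))

✶-distribʳ-+ : ∀ f g h n → ((λ k → f k + g k) ✶ h) n ≡ (f ✶ h) n + (g ✶ h) n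
✶-distribʳ-+ f g h n =
  trans (pairSum-cong n λ d e _ _ _ → ℤ.*-distribʳ-+ (h e) (f d) (g d)) (pairSum-+ n _ _)

✶-triple : ∀ f g h n → 1 ≤ n →
           (f ✶ (g ✶ h)) n ≡ ∑ n λ a → ∑ n λ b → ∑ n λ c → when (a ℕ.* (b ℕ.* c) ≟ n) (f a * (g b * h c))
✶-triple f g h n n≥1 = begin
  (f ✶ (g ✶ h)) n
    ≡⟨ ∑-cong n (λ a a≥1 _ → ∑-cong n λ m _ _ → expand a m a≥1) ⟩
  ∑ n (λ a → ∑ n λ m → ∑ n λ b → ∑ n λ c → when (a ℕ.* m ≟ n) (when (b ℕ.* c ≟ m) (X a b c)))
    ≡⟨ ∑-cong n (λ a _ _ → trans (∑-swap n n _) (∑-cong n λ b _ _ → ∑-swap n n _)) ⟩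
  ∑ n (λ a → ∑ n λ b → ∑ n λ c → ∑ n λ m → when (a ℕ.* m ≟ n) (when (b ℕ.* c ≟ m) (X a b c)))
    ≡⟨ ∑-cong n (λ a a≥1 _ → ∑-cong n λ b b≥1 _ → ∑-cong n λ c c≥1 _ → pick a b c a≥1 (1≤m*n b≥1 c≥1)) ⟩
  ∑ n (λ a → ∑ n λ b → ∑ n λ c → when (a ℕ.* (b ℕ.* c) ≟ n) (X a b c))
    ∎
  where
  open ≡-Reasoning
  X : ℕ → ℕ → ℕ → ℤ
  X a b c = f a * (g b * h c)

  expand : ∀ a m → 1 ≤ a → when (a ℕ.* m ≟ n) (f a * (g ✶ h) m) ≡
                           ∑ n λ b → ∑ n λ c → when (a ℕ.* m ≟ n) (when (b ℕ.* c ≟ m) (X a b c))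
  expand a m a≥1 = begin
    when (a ℕ.* m ≟ n) (f a * (g ✶ h) m)
      ≡⟨ when-cong (a ℕ.* m ≟ n) (λ am≡n →
           trans (pairSum-*ˡ m (f a) _) (pairSum-extend n _ (factor≤ʳ a≥1 am≡n))) ⟩
    when (a ℕ.* m ≟ n) (∑ n λ b → ∑ n λ c → when (b ℕ.* c ≟ m) (X a b c))
      ≡⟨ trans (when-∑ (a ℕ.* m ≟ n) n _) (∑-cong n λ b _ _ → when-∑ (a ℕ.* m ≟ n) n _) ⟩
    ∑ n (λ b → ∑ n λ c → when (a ℕ.* m ≟ n) (when (b ℕ.* c ≟ m) (X a b c)))
      ∎

  pick : ∀ a b c → 1 ≤ a → 1 ≤ b ℕ.* c →
         ∑ n (λ m → when (a ℕ.* m ≟ n) (when (b ℕ.* c ≟ m) (X a b c))) ≡ when (a ℕ.* (b ℕ.* c) ≟ n) (X a b c)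
  pick a b c a≥1 bc≥1 = begin
    ∑ n (λ m → when (a ℕ.* m ≟ n) (when (b ℕ.* c ≟ m) (X a b c)))
      ≡⟨ ∑-cong n (λ m _ _ → when-comm (a ℕ.* m ≟ n) (b ℕ.* c ≟ m)) ⟩
    ∑ n (λ m → when (b ℕ.* c ≟ m) (when (a ℕ.* m ≟ n) (X a b c)))
      ≡⟨ ∑-δ n (λ m → when (a ℕ.* m ≟ n) (X a b c)) bc≥1 ⟩
    when (b ℕ.* c ≤? n) (when (a ℕ.* (b ℕ.* c) ≟ n) (X a b c))
      ≡⟨ when-when (b ℕ.* c ≤? n) (a ℕ.* (b ℕ.* c) ≟ n) (factor≤ʳ a≥1) ⟩
    when (a ℕ.* (b ℕ.* c) ≟ n) (X a b c)
      ∎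

✶-assoc : ∀ f g h n → 1 ≤ n → ((f ✶ g) ✶ h) n ≡ (f ✶ (g ✶ h)) n
✶-assoc f g h n n≥1 = begin
  ((f ✶ g) ✶ h) n
    ≡⟨ ✶-comm (f ✶ g) h n ⟩
  (h ✶ (f ✶ g)) n
    ≡⟨ ✶-triple h f g n n≥1 ⟩
  ∑ n (λ c → ∑ n λ a → ∑ n λ b → when (c ℕ.* (a ℕ.* b) ≟ n) (h c * (f a * g b)))
    ≡⟨ trans (∑-swap n n _) (∑-cong n λ a _ _ → ∑-swap n n _) ⟩
  ∑ n (λ a → ∑ n λ b → ∑ n λ c → when (c ℕ.* (a ℕ.* b) ≟ n) (h c * (f a * g b)))
    ≡⟨ ∑-cong n (λ a _ _ → ∑-cong n λ b _ _ → ∑-cong n λ c _ _ →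
         cong₂ (λ x v → when (x ≟ n) v) (rotate c a b)
                                         (trans (ℤ.*-comm (h c) _) (ℤ.*-assoc (f a) (g b) (h c)))) ⟩
  ∑ n (λ a → ∑ n λ b → ∑ n λ c → when (a ℕ.* (b ℕ.* c) ≟ n) (f a * (g b * h c)))
    ≡⟨ ✶-triple f g h n n≥1 ⟨
  (f ✶ (g ✶ h)) n
    ∎
  where
  open ≡-Reasoning
  rotate : ∀ c a b → c ℕ.* (a ℕ.* b) ≡ a ℕ.* (b ℕ.* c)
  rotate c a b = trans (ℕ.*-comm c _) (ℕ.*-assoc a b c)

εD-≢1 : ∀ {d} → 1 ≤ d → d ≢ 1 → εD d ≡ + 0
εD-≢1 {suc zero}    _ d≢1 = contradiction refl d≢1
εD-≢1 {suc (suc _)} _ _   = refl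

εD✶ : ∀ h n → 1 ≤ n → (εD ✶ h) n ≡ h n
εD✶ h n n≥1 = begin
  (εD ✶ h) n                                   ≡⟨ ∑-single n ℕ.≤-refl n≥1 off-diagonal ⟩
  ∑ n (λ e → when (1 ℕ.* e ≟ n) (+ 1 * h e))   ≡⟨ ∑-single n n≥1 ℕ.≤-refl (λ e _ _ e≢n →
                                                     when-no (1 ℕ.* e ≟ n) (e≢n ∘ trans (sym (ℕ.*-identityˡ e)))) ⟩
  when (1 ℕ.* n ≟ n) (+ 1 * h n)              ≡⟨ when-yes (1 ℕ.* n ≟ n) (ℕ.*-identityˡ n) ⟩
  + 1 * h n                                    ≡⟨ ℤ.*-identityˡ (h n) ⟩
  h n                                          ∎
  where
  open ≡-Reasoning
  off-diagonal : ∀ d → 1 ≤ d → d ≤ n → d ≢ 1 → ∑ n (λ e → when (d ℕ.* e ≟ n) (εD d * h e)) ≡ + 0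
  off-diagonal d d≥1 _ d≢1 = ∑-ε n λ e _ _ →
    trans (when-cong (d ℕ.* e ≟ n) λ _ → cong (_* h e) (εD-≢1 d≥1 d≢1)) (when-ε (d ℕ.* e ≟ n))

𝟙 : ℕ → ℤ
𝟙 _ = + 1

ℙ : ℕ → ℤ
ℙ q = when (prime? q) (+ 1)

-- val, ω, Ω, ∏ α! and squarefreeness as sums over [1, n]

length≡foldr : ∀ (xs : List ℕ) → length xs ≡ foldr ℕ._+_ 0 (map (λ _ → 1) xs)
length≡foldr []       = refl
length≡foldr (x ∷ xs) = cong suc (length≡foldr xs)

sumℕ≡foldr : ∀ xs → sumℕ xs ≡ foldr ℕ._+_ 0 xs
sumℕ≡foldr []       = refl
sumℕ≡foldr (x ∷ xs) = cong (x ℕ.+_) (sumℕ≡foldr xs)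

prodFact-map : ∀ (g : ℕ → ℕ) xs → prodFact (map g xs) ≡ foldr ℕ._*_ 1 (map (λ x → g x !) xs)
prodFact-map g []       = refl
prodFact-map g (x ∷ xs) = cong (g x ! ℕ.*_) (prodFact-map g xs)

val≡∑ : ∀ p n → val p n ≡ Σℕ.∑ n (λ k → Σℕ.when (p ^ k ∣? n) 1)
val≡∑ p n = trans (length≡foldr (filter (λ k → p ^ k ∣? n) (range1 n)))
                  (trans (Σℕ.foldr-filter (λ k → p ^ k ∣? n) _ (range1 n)) (Σℕ.foldr-range1 n _))

ω≡∑ : ∀ n → ω n ≡ Σℕ.∑ n (λ q → Σℕ.when (primeDivisor? n q) 1)
ω≡∑ n = trans (length≡foldr (primeDivisors n)) (Σℕ.foldr-primeDivisors n _)

Ω≡∑ : ∀ n → Ω n ≡ Σℕ.∑ n (λ q → Σℕ.when (primeDivisor? n q) (val q n))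
Ω≡∑ n = trans (sumℕ≡foldr (map (λ p → val p n) (primeDivisors n))) (Σℕ.foldr-primeDivisors n _)

∏val! : ℕ → ℕ
∏val! n = prodFact (map (λ p → val p n) (primeDivisors n))

∏val!≢0 : ∀ n → ℕ.NonZero (∏val! n)
∏val!≢0 n = prodFact≢0 (map (λ p → val p n) (primeDivisors n))

∏val!≡∏ : ∀ n → ∏val! n ≡ Πℕ.∑ n (λ q → Πℕ.when (primeDivisor? n q) (val q n !))
∏val!≡∏ n = trans (prodFact-map _ (primeDivisors n)) (Πℕ.foldr-primeDivisors n _)

if-false-else≡foldr : ∀ (P : ℕ → Bool) {G : List ℕ → Bool} → G [] ≡ true →
                      (∀ p ps → G (p ∷ ps) ≡ (if P p then false else G ps)) →
                      ∀ xs → G xs ≡ foldr _∧_ true (map (not ∘ P) xs)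
if-false-else≡foldr P G[] G∷ []       = G[]
if-false-else≡foldr P G[] G∷ (x ∷ xs) with P x | G∷ x xs
... | true  | eq = eq
... | false | eq = trans eq (if-false-else≡foldr P G[] G∷ xs)

squarefree?≡⋀ : ∀ n → squarefree? n ≡ ⋀.∑ n (λ q → ⋀.when (primeDivisor? n q) (not (does (q ℕ.* q ∣? n))))
squarefree?≡⋀ n = trans go≡foldr (⋀.foldr-primeDivisors n _)
  where
  -- `squarefree?` recurses through a local `go`; abstracting over `primeDivisors n`
  -- lets unification take that `go` as the function G.
  go≡foldr : squarefree? n ≡ foldr _∧_ true (map (λ q → not (does (q ℕ.* q ∣? n))) (primeDivisors n))
  go≡foldr with if-false-else≡foldr (λ q → does (q ℕ.* q ∣? n)) refl (λ _ _ → refl) | primeDivisors n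
  ... | G≡foldr | ps = G≡foldr ps

val-∤ : ∀ {q n} → ¬ q ∣ n → val q n ≡ 0
val-∤ {q} {n} q∤n = trans (val≡∑ q n) (Σℕ.∑-ε n λ where
  (suc k) _ _ → Σℕ.when-no (q ^ suc k ∣? n) λ qᵏ⁺¹∣n → q∤n (∣-trans (m∣m*n (q ^ k)) qᵏ⁺¹∣n))

val-*-other : ∀ {q p e} → Prime q → Prime p → q ≢ p → 1 ≤ e → val q (p ℕ.* e) ≡ val q e
val-*-other {q} {p} {e} qp pp q≢p e≥1 = begin
  val q (p ℕ.* e)                                     ≡⟨ val≡∑ q (p ℕ.* e) ⟩
  Σℕ.∑ (p ℕ.* e) (λ k → Σℕ.when (q ^ k ∣? p ℕ.* e) 1) ≡⟨ Σℕ.∑-cong (p ℕ.* e) (λ k _ _ → cancel-p k) ⟩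
  Σℕ.∑ (p ℕ.* e) (λ k → Σℕ.when (q ^ k ∣? e) 1)       ≡⟨ Σℕ.∑-extend (p ℕ.* e) (ℕ.m≤n*m e p) (λ k e<k _ →
                                                           Σℕ.when-no (q ^ k ∣? e) (>⇒^∤ k (prime>1 qp) e≥1 e<k)) ⟩
  Σℕ.∑ e (λ k → Σℕ.when (q ^ k ∣? e) 1)               ≡⟨ val≡∑ q e ⟨
  val q e                                             ∎
  where
  open ≡-Reasoning
  instance _ = prime⇒nonZero pp
  cancel-p : ∀ k → Σℕ.when (q ^ k ∣? p ℕ.* e) 1 ≡ Σℕ.when (q ^ k ∣? e) 1
  cancel-p k = Σℕ.when-⇔ (q ^ k ∣? p ℕ.* e) (q ^ k ∣? e)
                         (^-∣-*-other qp pp q≢p k) (λ qᵏ∣e → ∣-trans qᵏ∣e (n∣m*n p))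

val-*-self : ∀ {p e} → Prime p → 1 ≤ e → val p (p ℕ.* e) ≡ suc (val p e)
val-*-self {p} {e} pp e≥1 = begin
  val p (p ℕ.* e)                         ≡⟨ val≡∑ p (p ℕ.* e) ⟩
  Σℕ.∑ (p ℕ.* e) [pᵏ∣pe]                  ≡⟨ cong (λ m → Σℕ.∑ m [pᵏ∣pe]) (ℕ.suc-pred (p ℕ.* e)) ⟨
  Σℕ.∑ (suc n′) [pᵏ∣pe]                   ≡⟨ Σℕ.∑-shift n′ [pᵏ∣pe] ⟩
  [pᵏ∣pe] 1 ℕ.+ Σℕ.∑ n′ ([pᵏ∣pe] ∘ suc)   ≡⟨ cong₂ ℕ._+_ (Σℕ.when-yes (p ^ 1 ∣? p ℕ.* e) (*-monoʳ-∣ p (1∣ e)))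
                                                         (Σℕ.∑-cong n′ λ k _ _ → cancel-p k) ⟩
  suc (Σℕ.∑ n′ [pᵏ∣e])                    ≡⟨ cong suc (Σℕ.∑-extend n′ (ℕ.<⇒≤pred (n<p*n pp e≥1)) λ k e<k _ →
                                               Σℕ.when-no (p ^ k ∣? e) (>⇒^∤ k (prime>1 pp) e≥1 e<k)) ⟩
  suc (Σℕ.∑ e [pᵏ∣e])                     ≡⟨ cong suc (val≡∑ p e) ⟨
  suc (val p e)                           ∎
  where
  open ≡-Reasoning
  instance _ = prime⇒nonZero pp
           _ = ℕ.m*n≢0 p e {{prime⇒nonZero pp}} {{>-nonZero e≥1}}
  n′ : ℕ
  n′ = ℕ.pred (p ℕ.* e)
  [pᵏ∣pe] [pᵏ∣e] : ℕ → ℕ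
  [pᵏ∣pe] k = Σℕ.when (p ^ k ∣? p ℕ.* e) 1
  [pᵏ∣e]  k = Σℕ.when (p ^ k ∣? e) 1
  cancel-p : ∀ k → [pᵏ∣pe] (suc k) ≡ [pᵏ∣e] k
  cancel-p k = Σℕ.when-⇔ (p ^ suc k ∣? p ℕ.* e) (p ^ k ∣? e) (*-cancelˡ-∣ p) (*-monoʳ-∣ p)

when-primeDivisor-val : ∀ {q} n → Prime q → Σℕ.when (primeDivisor? n q) (val q n) ≡ val q n
when-primeDivisor-val {q} n qp with primeDivisor? n q
... | yes pd = Σℕ.when-yes (primeDivisor? n q) pd
... | no ¬pd = trans (Σℕ.when-no (primeDivisor? n q) ¬pd) (sym (val-∤ λ q∣n → ¬pd (qp , q∣n)))

when-primeDivisor-val! : ∀ {q} n → Prime q → Πℕ.when (primeDivisor? n q) (val q n !) ≡ val q n !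
when-primeDivisor-val! {q} n qp with primeDivisor? n q
... | yes pd = Πℕ.when-yes (primeDivisor? n q) pd
... | no ¬pd = trans (Πℕ.when-no (primeDivisor? n q) ¬pd) (cong _! (sym (val-∤ λ q∣n → ¬pd (qp , q∣n))))

module _ {p e : ℕ} (pp : Prime p) (e≥1 : 1 ≤ e) where
  private
    p≥1 = prime≥1 pp
    open ≡-Reasoning

  Ω-*-prime : Ω (p ℕ.* e) ≡ suc (Ω e)
  Ω-*-prime = begin
    Ω (p ℕ.* e)                     ≡⟨ Ω≡∑ (p ℕ.* e) ⟩
    Σℕ.∑ (p ℕ.* e) (term (p ℕ.* e)) ≡⟨ Σℕ.∑-update-extend p≥1 e≥1 (λ q e<q → Σℕ.when-primeDivisor-> e≥1 e<q _)
                                                           at-p elsewhere ⟩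
    Σℕ.∑ e (term e) ℕ.+ 1           ≡⟨ cong (ℕ._+ 1) (Ω≡∑ e) ⟨
    Ω e ℕ.+ 1                       ≡⟨ ℕ.+-comm (Ω e) 1 ⟩
    suc (Ω e)                       ∎
    where
    term : ℕ → ℕ → ℕ
    term n q = Σℕ.when (primeDivisor? n q) (val q n)
    at-p : term (p ℕ.* e) p ≡ term e p ℕ.+ 1
    at-p = begin
      term (p ℕ.* e) p ≡⟨ when-primeDivisor-val (p ℕ.* e) pp ⟩
      val p (p ℕ.* e)  ≡⟨ val-*-self pp e≥1 ⟩
      suc (val p e)    ≡⟨ ℕ.+-comm 1 (val p e) ⟩
      val p e ℕ.+ 1    ≡⟨ cong (ℕ._+ 1) (when-primeDivisor-val e pp) ⟨
      term e p ℕ.+ 1   ∎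
    elsewhere : ∀ q → q ≢ p → term (p ℕ.* e) q ≡ term e q
    elsewhere q q≢p = trans (Σℕ.when-cong (primeDivisor? (p ℕ.* e) q) λ (qp , _) →
                                val-*-other qp pp q≢p e≥1)
                            (Σℕ.when-primeDivisor-* pp q≢p (val q e))

  ∏val!-*-prime : ∏val! (p ℕ.* e) ≡ ∏val! e ℕ.* suc (val p e)
  ∏val!-*-prime = begin
    ∏val! (p ℕ.* e)                   ≡⟨ ∏val!≡∏ (p ℕ.* e) ⟩
    Πℕ.∑ (p ℕ.* e) (term (p ℕ.* e))   ≡⟨ Πℕ.∑-update-extend p≥1 e≥1 (λ q e<q → Πℕ.when-primeDivisor-> e≥1 e<q _)
                                                             at-p elsewhere ⟩
    Πℕ.∑ e (term e) ℕ.* suc (val p e) ≡⟨ cong (ℕ._* suc (val p e)) (∏val!≡∏ e) ⟨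
    ∏val! e ℕ.* suc (val p e)         ∎
    where
    term : ℕ → ℕ → ℕ
    term n q = Πℕ.when (primeDivisor? n q) (val q n !)
    at-p : term (p ℕ.* e) p ≡ term e p ℕ.* suc (val p e)
    at-p = begin
      term (p ℕ.* e) p            ≡⟨ when-primeDivisor-val! (p ℕ.* e) pp ⟩
      val p (p ℕ.* e) !           ≡⟨ cong _! (val-*-self pp e≥1) ⟩
      suc (val p e) !             ≡⟨ ℕ.*-comm (suc (val p e)) _ ⟩
      val p e ! ℕ.* suc (val p e) ≡⟨ cong (ℕ._* suc (val p e)) (when-primeDivisor-val! e pp) ⟨
      term e p ℕ.* suc (val p e)  ∎
    elsewhere : ∀ q → q ≢ p → term (p ℕ.* e) q ≡ term e q
    elsewhere q q≢p = trans (Πℕ.when-cong (primeDivisor? (p ℕ.* e) q) λ (qp , _) →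
                                cong _! (val-*-other qp pp q≢p e≥1))
                            (Πℕ.when-primeDivisor-* pp q≢p (val q e !))

  liouville-*-prime : liouville (p ℕ.* e) ≡ - liouville e
  liouville-*-prime = cong neg1^ Ω-*-prime

  module _ (p∤e : ¬ p ∣ e) where
    ω-*-prime : ω (p ℕ.* e) ≡ suc (ω e)
    ω-*-prime = begin
      ω (p ℕ.* e)                     ≡⟨ ω≡∑ (p ℕ.* e) ⟩
      Σℕ.∑ (p ℕ.* e) (term (p ℕ.* e)) ≡⟨ Σℕ.∑-update-extend p≥1 e≥1 (λ q e<q → Σℕ.when-primeDivisor-> e≥1 e<q 1)
                                                             at-p (λ q q≢p → Σℕ.when-primeDivisor-* pp q≢p 1) ⟩
      Σℕ.∑ e (term e) ℕ.+ 1           ≡⟨ cong (ℕ._+ 1) (ω≡∑ e) ⟨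
      ω e ℕ.+ 1                       ≡⟨ ℕ.+-comm (ω e) 1 ⟩
      suc (ω e)                       ∎
      where
      term : ℕ → ℕ → ℕ
      term n q = Σℕ.when (primeDivisor? n q) 1
      at-p : term (p ℕ.* e) p ≡ term e p ℕ.+ 1
      at-p = trans (Σℕ.when-yes (primeDivisor? (p ℕ.* e) p) (pp , m∣m*n e))
                   (cong (ℕ._+ 1) (sym (Σℕ.when-no (primeDivisor? e p) (p∤e ∘ proj₂))))

    squarefree?-*-prime : squarefree? (p ℕ.* e) ≡ squarefree? e
    squarefree?-*-prime = begin
      squarefree? (p ℕ.* e)          ≡⟨ squarefree?≡⋀ (p ℕ.* e) ⟩
      ⋀.∑ (p ℕ.* e) (term (p ℕ.* e)) ≡⟨ ⋀.∑-update-extend p≥1 e≥1 (λ q e<q → ⋀.when-primeDivisor-> e≥1 e<q _)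
                                                            at-p elsewhere ⟩
      ⋀.∑ e (term e) ∧ true          ≡⟨ ∧-identityʳ _ ⟩
      ⋀.∑ e (term e)                 ≡⟨ squarefree?≡⋀ e ⟨
      squarefree? e                  ∎
      where
      term : ℕ → ℕ → Bool
      term n q = ⋀.when (primeDivisor? n q) (not (does (q ℕ.* q ∣? n)))
      at-p : term (p ℕ.* e) p ≡ term e p ∧ true
      at-p = begin
        term (p ℕ.* e) p                ≡⟨ ⋀.when-yes (primeDivisor? (p ℕ.* e) p) (pp , m∣m*n e) ⟩
        not (does (p ℕ.* p ∣? p ℕ.* e)) ≡⟨ cong not (dec-false (p ℕ.* p ∣? p ℕ.* e) (p∤e ∘ *-cancelˡ-∣ p)) ⟩
        true                            ≡⟨ ⋀.when-no (primeDivisor? e p) (p∤e ∘ proj₂) ⟨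
        term e p                        ≡⟨ ∧-identityʳ _ ⟨
        term e p ∧ true                 ∎
        where instance _ = prime⇒nonZero pp
      elsewhere : ∀ q → q ≢ p → term (p ℕ.* e) q ≡ term e q
      elsewhere q q≢p = trans
        (⋀.when-cong (primeDivisor? (p ℕ.* e) q) λ (qp , _) → cong not (does-⇔ (mk⇔
          (λ q²∣pe → ^2⇒square (^-∣-*-other qp pp q≢p 2 (square⇒^2 q²∣pe))) (λ q²∣e → ∣-trans q²∣e (n∣m*n p)))
          (q ℕ.* q ∣? p ℕ.* e) (q ℕ.* q ∣? e)))
        (⋀.when-primeDivisor-* pp q≢p _)
        where
        square⇒^2 : ∀ {n} → q ℕ.* q ∣ n → q ^ 2 ∣ n
        square⇒^2 {n} = subst (_∣ n) (cong (q ℕ.*_) (sym (ℕ.*-identityʳ q)))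
        ^2⇒square : ∀ {n} → q ^ 2 ∣ n → q ℕ.* q ∣ n
        ^2⇒square {n} = subst (_∣ n) (cong (q ℕ.*_) (ℕ.*-identityʳ q))

    μ-*-prime : μ (p ℕ.* e) ≡ - μ e
    μ-*-prime = trans (cong₂ (λ b w → if b then neg1^ w else + 0) squarefree?-*-prime ω-*-prime)
                      (sym (if-float -_ (squarefree? e)))

  μ-*-prime-∣ : p ∣ e → μ (p ℕ.* e) ≡ + 0
  μ-*-prime-∣ p∣e = cong (λ b → if b then neg1^ (ω (p ℕ.* e)) else + 0) not-squarefree
    where
    not-squarefree : squarefree? (p ℕ.* e) ≡ false
    not-squarefree = trans (squarefree?≡⋀ (p ℕ.* e))
      (⋀.∑-absorbing (p ℕ.* e) ∧-zeroʳ p≥1 (ℕ.m≤m*n p e {{>-nonZero e≥1}})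
        (trans (⋀.when-yes (primeDivisor? (p ℕ.* e) p) (pp , m∣m*n e))
               (cong not (dec-true (p ℕ.* p ∣? p ℕ.* e) (*-monoʳ-∣ p p∣e)))))

-- Möbius inversion

-- Fix a prime p ∣ n. Each divisor j with p ∤ j cancels against p·j, since μ (p·j) = −μ j;
-- the remaining divisors p·j with p ∣ j have μ (p·j) = 0.
∑-μ-divisors : ∀ n → 1 ≤ n → ∑ n (λ d → when (d ∣? n) (μ d)) ≡ εD n
∑-μ-divisors (suc zero)        _ = refl
∑-μ-divisors n@(suc (suc _)) _ with prime-divisor n (s≤s (s≤s z≤n))
... | p , pp , p∣n = begin
  ∑ n T                                                          ≡⟨ ∑-cong n (λ d _ _ → when-split (p ∣? d) (T d)) ⟩
  ∑ n (λ d → when (p ∣? d) (T d) + B d)                          ≡⟨ ∑-distrib n _ B ⟩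
  ∑ n (λ d → when (p ∣? d) (T d)) + ∑ n B                        ≡⟨ cong (_+ ∑ n B) (∑-multiples n T (prime≥1 pp)) ⟩
  ∑ n (λ j → when (p ℕ.* j ≤? n) (T (p ℕ.* j))) + ∑ n B          ≡⟨ cong (_+ ∑ n B) (∑-cong n λ j j≥1 _ → multiple j j≥1) ⟩
  ∑ n (λ j → - B j) + ∑ n B                                      ≡⟨ cong (_+ ∑ n B) (∑-neg n B) ⟩
  - ∑ n B + ∑ n B                                                ≡⟨ ℤ.+-inverseˡ (∑ n B) ⟩
  + 0                                                            ∎
  where
  open ≡-Reasoning
  T B : ℕ → ℤ
  T d = when (d ∣? n) (μ d)
  B d = when (¬? (p ∣? d)) (T d)
  multiple : ∀ j → 1 ≤ j → when (p ℕ.* j ≤? n) (T (p ℕ.* j)) ≡ - B j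
  multiple j j≥1 with p ∣? j
  ... | yes p∣j = begin
    when (p ℕ.* j ≤? n) (when (p ℕ.* j ∣? n) (μ (p ℕ.* j))) ≡⟨ cong (λ x → when (p ℕ.* j ≤? n) (when (p ℕ.* j ∣? n) x))
                                                                  (μ-*-prime-∣ pp j≥1 p∣j) ⟩
    when (p ℕ.* j ≤? n) (when (p ℕ.* j ∣? n) (+ 0))         ≡⟨ cong (when (p ℕ.* j ≤? n)) (when-ε (p ℕ.* j ∣? n)) ⟩
    when (p ℕ.* j ≤? n) (+ 0)                               ≡⟨ when-ε (p ℕ.* j ≤? n) ⟩
    + 0                                                     ∎
  ... | no  p∤j = begin
    when (p ℕ.* j ≤? n) (when (p ℕ.* j ∣? n) (μ (p ℕ.* j))) ≡⟨ when-when (p ℕ.* j ≤? n) (p ℕ.* j ∣? n) ∣⇒≤ ⟩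
    when (p ℕ.* j ∣? n) (μ (p ℕ.* j))                       ≡⟨ when-⇔ (p ℕ.* j ∣? n) (j ∣? n)
                                                                  (∣-trans (n∣m*n p)) (λ j∣n → prime∤⇒*-∣ pp p∤j j∣n p∣n) ⟩
    when (j ∣? n) (μ (p ℕ.* j))                             ≡⟨ cong (when (j ∣? n)) (μ-*-prime pp j≥1 p∤j) ⟩
    when (j ∣? n) (- μ j)                                   ≡⟨ -when (j ∣? n) (μ j) ⟨
    - when (j ∣? n) (μ j)                                   ∎

μ✶𝟙 : ∀ n → 1 ≤ n → (μ ✶ 𝟙) n ≡ εD n
μ✶𝟙 n n≥1 = begin
  (μ ✶ 𝟙) n                       ≡⟨ pairSum-cong n (λ d _ _ _ _ → ℤ.*-identityʳ (μ d)) ⟩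
  pairSum n (λ d _ → μ d)         ≡⟨ pairSum-divisors n μ n≥1 ⟩
  ∑ n (λ d → when (d ∣? n) (μ d)) ≡⟨ ∑-μ-divisors n n≥1 ⟩
  εD n                            ∎
  where open ≡-Reasoning

möbius-inversion : ∀ h n → 1 ≤ n → ((𝟙 ✶ h) ✶ μ) n ≡ h n
möbius-inversion h n n≥1 = begin
  ((𝟙 ✶ h) ✶ μ) n ≡⟨ ✶-comm (𝟙 ✶ h) μ n ⟩
  (μ ✶ (𝟙 ✶ h)) n ≡⟨ ✶-assoc μ 𝟙 h n n≥1 ⟨
  ((μ ✶ 𝟙) ✶ h) n ≡⟨ ✶-congˡ h n (λ d d≥1 _ → μ✶𝟙 d d≥1) ⟩
  (εD ✶ h) n      ≡⟨ εD✶ h n n≥1 ⟩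
  h n             ∎
  where open ≡-Reasoning

-- The multinomial coefficient CΩ

CΩ-column : ∀ {m w} q → 1 ≤ m → Ω m ≡ suc w → (∀ e → 1 ≤ e → e < m → CΩ e ℕ.* ∏val! e ≡ Ω e !) →
            ∑ m (λ e → when (q ℕ.* e ≟ m) (+ ∏val! m * (ℙ q * + CΩ e)))
              ≡ + (w !) * + Σℕ.when (primeDivisor? m q) (val q m)
CΩ-column {m} {w} q m≥1 Ωm≡1+w multinomial = by-cases (q ∣? m) (prime? q)
  where
  open ≡-Reasoning
  LHS RHS : ℤ
  LHS = ∑ m (λ e → when (q ℕ.* e ≟ m) (+ ∏val! m * (ℙ q * + CΩ e)))
  RHS = + (w !) * + Σℕ.when (primeDivisor? m q) (val q m)

  RHS≡0 : ¬ PrimeDivisor m q → RHS ≡ + 0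
  RHS≡0 ¬pd = trans (cong (λ x → + (w !) * + x) (Σℕ.when-no (primeDivisor? m q) ¬pd)) (ℤ.*-zeroʳ (+ (w !)))

  by-cases : Dec (q ∣ m) → Dec (Prime q) → LHS ≡ RHS
  by-cases (no q∤m) _ = trans (∑-cofactor-∤ m q _ q∤m) (sym (RHS≡0 (q∤m ∘ proj₂)))
  by-cases (yes (divides e m≡eq)) (no ¬qp) = begin
    LHS                         ≡⟨ ∑-cofactor m q _ m≥1 ℕ.≤-refl (trans (ℕ.*-comm q e) (sym m≡eq)) ⟩
    + ∏val! m * (ℙ q * + CΩ e)  ≡⟨ cong (λ x → + ∏val! m * (x * + CΩ e)) (when-no (prime? q) ¬qp) ⟩
    + ∏val! m * + 0             ≡⟨ ℤ.*-zeroʳ (+ ∏val! m) ⟩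
    + 0                         ≡⟨ RHS≡0 (¬qp ∘ proj₁) ⟨
    RHS                         ∎
  by-cases (yes q∣m@(divides e m≡eq)) (yes qp) = begin
    LHS                                                ≡⟨ ∑-cofactor m q _ m≥1 ℕ.≤-refl qe≡m ⟩
    + ∏val! m * (ℙ q * + CΩ e)                         ≡⟨ cong (λ x → + ∏val! m * (x * + CΩ e)) (when-yes (prime? q) qp) ⟩
    + ∏val! m * (+ 1 * + CΩ e)                         ≡⟨ cong (+ ∏val! m *_) (ℤ.*-identityˡ (+ CΩ e)) ⟩
    + ∏val! m * + CΩ e                                 ≡⟨ ℤ.pos-* (∏val! m) (CΩ e) ⟨
    + (∏val! m ℕ.* CΩ e)                               ≡⟨ cong +_ counted ⟩
    + (w ! ℕ.* val q m)                                ≡⟨ ℤ.pos-* (w !) (val q m) ⟩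
    + (w !) * + val q m                                ≡⟨ cong (λ x → + (w !) * + x)
                                                              (Σℕ.when-yes (primeDivisor? m q) (qp , q∣m)) ⟨
    RHS                                                ∎
    where
    qe≡m : q ℕ.* e ≡ m
    qe≡m = trans (ℕ.*-comm q e) (sym m≡eq)
    e≥1 : 1 ≤ e
    e≥1 = 1≤m*n⇒1≤n q e (subst (1 ≤_) (sym qe≡m) m≥1)
    e<m : e < m
    e<m = subst (e <_) qe≡m (n<p*n qp e≥1)
    Ωe≡w : Ω e ≡ w
    Ωe≡w = ℕ.suc-injective (trans (sym (Ω-*-prime qp e≥1)) (trans (cong Ω qe≡m) Ωm≡1+w))
    counted : ∏val! m ℕ.* CΩ e ≡ w ! ℕ.* val q m
    counted = begin
      ∏val! m ℕ.* CΩ e                      ≡⟨ cong (λ x → ∏val! x ℕ.* CΩ e) qe≡m ⟨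
      ∏val! (q ℕ.* e) ℕ.* CΩ e              ≡⟨ cong (ℕ._* CΩ e) (∏val!-*-prime qp e≥1) ⟩
      ∏val! e ℕ.* suc (val q e) ℕ.* CΩ e    ≡⟨ ℕ.*-comm (∏val! e ℕ.* _) (CΩ e) ⟩
      CΩ e ℕ.* (∏val! e ℕ.* suc (val q e))  ≡⟨ ℕ.*-assoc (CΩ e) (∏val! e) _ ⟨
      CΩ e ℕ.* ∏val! e ℕ.* suc (val q e)    ≡⟨ cong₂ ℕ._*_ (trans (multinomial e e≥1 e<m) (cong _! Ωe≡w))
                                                         (sym (val-*-self qp e≥1)) ⟩
      w ! ℕ.* val q (q ℕ.* e)               ≡⟨ cong (λ x → w ! ℕ.* val q x) qe≡m ⟩
      w ! ℕ.* val q m                       ∎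

-- Pascal's rule for multinomial coefficients, multiplied by the denominator ∏val! m:
-- Σ_{q ∣ m prime} CΩ(m/q) · ∏val! m = Σ_q (Ω m − 1)! · val q m = Ω m !.
ℙ✶CΩ*∏val!≡Ω! : ∀ m → 2 ≤ m → (∀ e → 1 ≤ e → e < m → CΩ e ℕ.* ∏val! e ≡ Ω e !) →
         (ℙ ✶ (+_ ∘ CΩ)) m * + ∏val! m ≡ + (Ω m !)
ℙ✶CΩ*∏val!≡Ω! m m≥2 multinomial with prime-divisor m m≥2
... | p , pp , divides e₀ m≡e₀p = begin
  (ℙ ✶ (+_ ∘ CΩ)) m * + ∏val! m                                 ≡⟨ ℤ.*-comm _ (+ ∏val! m) ⟩
  + ∏val! m * (ℙ ✶ (+_ ∘ CΩ)) m                                 ≡⟨ pairSum-*ˡ m (+ ∏val! m) _ ⟩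
  pairSum m (λ q e → + ∏val! m * (ℙ q * + CΩ e))                ≡⟨ ∑-cong m (λ q _ _ → CΩ-column q m≥1 Ωm≡1+w multinomial) ⟩
  ∑ m (λ q → + (w !) * + Σℕ.when (primeDivisor? m q) (val q m))  ≡⟨ ∑-*ˡ m (+ (w !)) _ ⟨
  + (w !) * ∑ m (λ q → + Σℕ.when (primeDivisor? m q) (val q m))  ≡⟨ cong (+ (w !) *_) (+∑ m _) ⟨
  + (w !) * + Σℕ.∑ m (λ q → Σℕ.when (primeDivisor? m q) (val q m))
                                                                ≡⟨ cong (λ x → + (w !) * + x) (Ω≡∑ m) ⟨
  + (w !) * + Ω m                                               ≡⟨ ℤ.pos-* (w !) (Ω m) ⟨
  + (w ! ℕ.* Ω m)                                               ≡⟨ cong (λ x → + (w ! ℕ.* x)) Ωm≡1+w ⟩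
  + (w ! ℕ.* suc w)                                             ≡⟨ cong +_ (ℕ.*-comm (w !) (suc w)) ⟩
  + (suc w !)                                                   ≡⟨ cong (λ x → + (x !)) Ωm≡1+w ⟨
  + (Ω m !)                                                     ∎
  where
  open ≡-Reasoning
  m≥1 : 1 ≤ m
  m≥1 = ℕ.<⇒≤ m≥2
  pe₀≡m : p ℕ.* e₀ ≡ m
  pe₀≡m = trans (ℕ.*-comm p e₀) (sym m≡e₀p)
  w : ℕ
  w = Ω e₀
  Ωm≡1+w : Ω m ≡ suc w
  Ωm≡1+w = trans (cong Ω (sym pe₀≡m)) (Ω-*-prime pp (1≤m*n⇒1≤n p e₀ (subst (1 ≤_) (sym pe₀≡m) m≥1)))

CΩ*∏val!≡Ω! : ∀ m → 1 ≤ m → CΩ m ℕ.* ∏val! m ≡ Ω m !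
CΩ*∏val!≡Ω! = <-rec _ step
  where
  step : ∀ m → (∀ {e} → e < m → 1 ≤ e → CΩ e ℕ.* ∏val! e ≡ Ω e !) → 1 ≤ m → CΩ m ℕ.* ∏val! m ≡ Ω m !
  step (suc zero)      _  _ = refl
  step m@(suc (suc _)) IH _ = m/n*n≡m {{∏val!≢0 m}} (divides ∣ X ∣ Ω!≡∣X∣*E)
    where
    X : ℤ
    X = (ℙ ✶ (+_ ∘ CΩ)) m
    Ω!≡∣X∣*E : Ω m ! ≡ ∣ X ∣ ℕ.* ∏val! m
    Ω!≡∣X∣*E = trans (cong ∣_∣ (sym (ℙ✶CΩ*∏val!≡Ω! m (s≤s (s≤s z≤n)) λ e e≥1 e<m → IH e<m e≥1)))
                     (ℤ.abs-* X (+ ∏val! m))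

CΩ-recursion : ∀ m → 2 ≤ m → + CΩ m ≡ (ℙ ✶ (+_ ∘ CΩ)) m
CΩ-recursion m m≥2 = ℤ.*-cancelʳ-≡ (+ CΩ m) _ (+ ∏val! m) {{∏val!≢0 m}} (begin
  + CΩ m * + ∏val! m         ≡⟨ ℤ.pos-* (CΩ m) (∏val! m) ⟨
  + (CΩ m ℕ.* ∏val! m)       ≡⟨ cong +_ (CΩ*∏val!≡Ω! m (ℕ.<⇒≤ m≥2)) ⟩
  + (Ω m !)                  ≡⟨ ℙ✶CΩ*∏val!≡Ω! m m≥2 (λ e e≥1 _ → CΩ*∏val!≡Ω! e e≥1) ⟨
  (ℙ ✶ (+_ ∘ CΩ)) m * + ∏val! m ∎)
  where open ≡-Reasoning

-- The Dirichlet inverse of ω + 1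

ℙ✶-cong : ∀ {u v} n → (∀ e → 1 ≤ e → e < n → u e ≡ v e) → (ℙ ✶ u) n ≡ (ℙ ✶ v) n
ℙ✶-cong {u} {v} n u≡v = pairSum-cong n term
  where
  term : ∀ q e → 1 ≤ q → 1 ≤ e → q ℕ.* e ≡ n → ℙ q * u e ≡ ℙ q * v e
  term q e _ e≥1 qe≡n with prime? q
  ... | no  _  = refl
  ... | yes qp = cong (+ 1 *_) (u≡v e e≥1 (subst (e <_) qe≡n (n<p*n qp e≥1)))

SolvesℙRecursion : (ℕ → ℤ) → Set
SolvesℙRecursion u = ∀ n → 1 ≤ n → u n + (ℙ ✶ u) n ≡ εD n

ℙ-recursion-unique : ∀ {u v} → SolvesℙRecursion u → SolvesℙRecursion v → ∀ n → 1 ≤ n → u n ≡ v n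
ℙ-recursion-unique {u} {v} u-rec v-rec = <-rec _ step
  where
  step : ∀ n → (∀ {e} → e < n → 1 ≤ e → u e ≡ v e) → 1 ≤ n → u n ≡ v n
  step n IH n≥1 = ∙-cancelʳ ((ℙ ✶ u) n) (u n) (v n) (begin
    u n + (ℙ ✶ u) n ≡⟨ u-rec n n≥1 ⟩
    εD n            ≡⟨ v-rec n n≥1 ⟨
    v n + (ℙ ✶ v) n ≡⟨ cong (_+_ (v n)) (ℙ✶-cong n λ e e≥1 e<n → IH e<n e≥1) ⟨
    v n + (ℙ ✶ u) n ∎)
    where open ≡-Reasoning

λCΩ : ℕ → ℤ
λCΩ n = liouville n * + CΩ n

λCΩ-recursion : SolvesℙRecursion λCΩ
λCΩ-recursion (suc zero)      _ = refl
λCΩ-recursion n@(suc (suc _)) _ = begin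
  λCΩ n + (ℙ ✶ λCΩ) n                               ≡⟨ cong (_+_ (λCΩ n)) flip-sign ⟩
  λCΩ n + - liouville n * (ℙ ✶ (+_ ∘ CΩ)) n         ≡⟨ cong (λ x → λCΩ n + - liouville n * x)
                                                           (CΩ-recursion n (s≤s (s≤s z≤n))) ⟨
  liouville n * + CΩ n + - liouville n * + CΩ n     ≡⟨ ℤ.*-distribʳ-+ (+ CΩ n) (liouville n) (- liouville n) ⟨
  (liouville n + - liouville n) * + CΩ n            ≡⟨ cong (_* + CΩ n) (ℤ.+-inverseʳ (liouville n)) ⟩
  + 0                                               ∎
  where
  open ≡-Reasoning
  term : ∀ q e → 1 ≤ q → 1 ≤ e → q ℕ.* e ≡ n → ℙ q * λCΩ e ≡ - liouville n * (ℙ q * + CΩ e)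
  term q e _ e≥1 qe≡n with prime? q
  ... | no  _  = sym (ℤ.*-zeroʳ (- liouville n))
  ... | yes qp = begin
    + 1 * (liouville e * + CΩ e)   ≡⟨ x∙yz≈y∙xz (+ 1) (liouville e) (+ CΩ e) ⟩
    liouville e * (+ 1 * + CΩ e)   ≡⟨ cong (_* (+ 1 * + CΩ e)) (ℤ.neg-involutive (liouville e)) ⟨
    - - liouville e * (+ 1 * + CΩ e) ≡⟨ cong (λ x → - x * (+ 1 * + CΩ e))
                                          (trans (cong liouville (sym qe≡n)) (liouville-*-prime qp e≥1)) ⟨
    - liouville n * (+ 1 * + CΩ e) ∎
  flip-sign : (ℙ ✶ λCΩ) n ≡ - liouville n * (ℙ ✶ (+_ ∘ CΩ)) n
  flip-sign = trans (pairSum-cong n term) (sym (pairSum-*ˡ n (- liouville n) _))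

ω≡ℙ✶𝟙 : ∀ d → 1 ≤ d → + ω d ≡ (ℙ ✶ 𝟙) d
ω≡ℙ✶𝟙 d d≥1 = begin
  + ω d                                             ≡⟨ cong +_ (ω≡∑ d) ⟩
  + Σℕ.∑ d (λ q → Σℕ.when (primeDivisor? d q) 1)   ≡⟨ +∑ d _ ⟩
  ∑ d (λ q → + Σℕ.when (primeDivisor? d q) 1)      ≡⟨ ∑-cong d (λ q _ _ → indicator q) ⟩
  ∑ d (λ q → when (q ∣? d) (ℙ q))                  ≡⟨ pairSum-divisors d ℙ d≥1 ⟨
  pairSum d (λ q _ → ℙ q)                           ≡⟨ pairSum-cong d (λ q _ _ _ _ → ℤ.*-identityʳ (ℙ q)) ⟨
  (ℙ ✶ 𝟙) d                                         ∎
  where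
  open ≡-Reasoning
  indicator : ∀ q → + Σℕ.when (primeDivisor? d q) 1 ≡ when (q ∣? d) (ℙ q)
  indicator q with prime? q | q ∣? d
  ... | yes _ | yes _ = refl
  ... | yes _ | no  _ = refl
  ... | no  _ | yes _ = refl
  ... | no  _ | no  _ = refl

𝟙✶inverse-recursion : ∀ {ginv} → IsDirichletInverse gω ginv → SolvesℙRecursion (𝟙 ✶ ginv)
𝟙✶inverse-recursion {ginv} inverse n n≥1 = begin
  (𝟙 ✶ ginv) n + (ℙ ✶ (𝟙 ✶ ginv)) n    ≡⟨ cong (_+_ ((𝟙 ✶ ginv) n)) (✶-assoc ℙ 𝟙 ginv n n≥1) ⟨
  (𝟙 ✶ ginv) n + ((ℙ ✶ 𝟙) ✶ ginv) n    ≡⟨ ✶-distribʳ-+ 𝟙 (ℙ ✶ 𝟙) ginv n ⟨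
  ((λ d → + 1 + (ℙ ✶ 𝟙) d) ✶ ginv) n   ≡⟨ ✶-congˡ ginv n (λ d d≥1 _ → gω≡1+ℙ✶𝟙 d d≥1) ⟨
  (gω ✶ ginv) n                         ≡⟨ ⋆≡✶ gω ginv n n≥1 ⟨
  (gω ⋆ ginv) n                         ≡⟨ inverse n n≥1 ⟩
  εD n                                  ∎
  where
  open ≡-Reasoning
  gω≡1+ℙ✶𝟙 : ∀ d → 1 ≤ d → gω d ≡ + 1 + (ℙ ✶ 𝟙) d
  gω≡1+ℙ✶𝟙 d d≥1 = trans (ℤ.pos-+ (ω d) 1)
                          (trans (ℤ.+-comm (+ ω d) (+ 1)) (cong (_+_ (+ 1)) (ω≡ℙ✶𝟙 d d≥1)))

lemma3p2 : (ginv : ℕ → ℤ) → IsDirichletInverse gω ginv →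
    ∀ n → 1 ≤ n →
    ginv n ≡ divisorSum n (λ d e → μ e * (liouville d * + CΩ d))
lemma3p2 ginv inverse n n≥1 = begin
  ginv n                          ≡⟨ möbius-inversion ginv n n≥1 ⟨
  ((𝟙 ✶ ginv) ✶ μ) n              ≡⟨ ✶-congˡ μ n (λ d d≥1 _ → 𝟙✶ginv≡λCΩ d d≥1) ⟩
  (λCΩ ✶ μ) n                     ≡⟨ pairSum-cong n (λ d e _ _ _ → ℤ.*-comm (λCΩ d) (μ e)) ⟩
  pairSum n (λ d e → μ e * λCΩ d) ≡⟨ divisorSum≡pairSum n _ n≥1 ⟨
  divisorSum n (λ d e → μ e * λCΩ d) ∎
  where
  open ≡-Reasoning
  𝟙✶ginv≡λCΩ : ∀ d → 1 ≤ d → (𝟙 ✶ ginv) d ≡ λCΩ d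
  𝟙✶ginv≡λCΩ = ℙ-recursion-unique (𝟙✶inverse-recursion inverse) λCΩ-recursion
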